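{- Let $\Sigma$ be a finite totally ordered alphabet, let $W = a_1 a_2 \cdots a_n \in \Sigma^+$, and let $W = L_1 L_2 \cdots L_k$ be its Lyndon factorization. Fix $1 \le r \le s \le k$ and let $u = L_r L_{r+1} \cdots L_s$, which occupies positions $first(u)$ through $last(u)$ of $W$. Then for all indices $i, j$ with $first(u) \le i < j \le last(u)$, $$suf_u(i) < suf_u(j) \iff suf_W(i) < suf_W(j),$$ where $<$ denotes the lexicographic order.
   Context: Words are compared in the usual lexicographic order on $\Sigma^*$ induced by the order of $\Sigma$; a proper prefix of a word is smaller than the word. Two words $x,y$ are conjugate if $x=pq$ and $y=qp$ for some words $p,q$. A Lyndon word is a primitive nonempty word that is strictly smaller than all of its other conjugates. The Lyndon factorization of $W$ is the unique factorization $W = L_1 L_2 \cdots L_k$ into Lyndon words with $L_1 \ge L_2 \ge \cdots \ge L_k$ lexicographically. For a factor $u$ of $W$ occurring at positions $first(u)$ through $last(u)$, and a position $i$ with $first(u)\le i\le last(u)$, the local suffix is $suf_u(i) = W[i, last(u)] = a_i a_{i+1}\cdots a_{last(u)}$, and the global suffix is $suf_W(i) = W[i,n] = a_i \cdots a_n$. -}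

module Defs where

open import Data.Nat using (ℕ; _≥_)
open import Data.Fin using (Fin)
import Data.Fin as F
open import Data.List using (List; []; _∷_; _++_; concat; replicate)
open import Data.List.Relation.Binary.Lex.Core using (Lex-<; Lex-≤)
open import Data.List.Relation.Unary.All using (All)
open import Data.List.Relation.Unary.Linked using (Linked)
open import Data.Product using (Σ; _×_; ∃)
open import Relation.Binary.PropositionalEquality using (_≡_; _≢_)
open import Relation.Nullary using (¬_)

-- The alphabet Σ: a finite totally ordered set, represented (up to
-- order-isomorphism) as Fin m with its natural order.
Word : ℕ → Set
Word m = List (Fin m)

_<ʷ_ : ∀ {m} → Word m → Word m → Set
_<ʷ_ = Lex-< _≡_ F._<_

_≤ʷ_ : ∀ {m} → Word m → Word m → Set
_≤ʷ_ = Lex-≤ _≡_ F._<_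

Primitive : ∀ {m} → Word m → Set
Primitive {m} w = ¬ (Σ (Word m) λ u → Σ ℕ λ k → (k ≥ 2) × (w ≡ concat (replicate k u)))

Lyndon : ∀ {m} → Word m → Set
Lyndon {m} w =
  (w ≢ []) × Primitive w ×
  (∀ (p q : Word m) → w ≡ p ++ q → q ++ p ≢ w → w <ʷ (q ++ p))

IsLyndonFactorization : ∀ {m} → Word m → List (Word m) → Set
IsLyndonFactorization W Ls =
  All Lyndon Ls × Linked (λ x y → y ≤ʷ x) Ls × (concat Ls ≡ W)

-- Put v = L_{s+1} ⋯ L_k. The heart of the matter is that v is smaller than
-- every suffix z v of W with z a nonempty suffix of u. Such a suffix is
-- t L_{q+1} ⋯ L_k with t a nonempty suffix of some factor L_q of u. Being
-- unbordered, a Lyndon word L differs from each proper suffix t at a position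
-- inside t, with the smaller letter in L, so L X ≤ t X; and L X > X whenever X
-- is a concatenation of words ≤ L. Hence z v ≥ L_q ⋯ L_k > L_{q+1} ⋯ L_k ≥ v.
-- Now let x = suf_u(i) and y = suf_u(j), so y is shorter. If x < y they differ
-- at a position inside y, and appending v changes nothing. If x v < y v but not
-- x < y, then x = y z and z v < v, contradicting the fact above.
module Submission where

open import Defs
open import Data.Empty using (⊥; ⊥-elim)
open import Data.Fin using (Fin)
import Data.Fin as F
import Data.Fin.Properties as Finₚ
open import Data.List using (List; []; _∷_; _++_; concat; replicate; length; drop)
open import Data.List.Properties
  using (++-assoc; ++-identityʳ; ++-identityˡ-unique; ++-conicalˡ; ++-conicalʳ;
         ∷-injective; length-++; length-++-≤ʳ; length-drop; take++drop≡id; concat-++)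
import Data.List.Relation.Binary.Lex.Strict as Lex
open import Data.List.Relation.Binary.Lex.Core using (base; halt; this; next)
open import Data.List.Relation.Binary.Pointwise using (Pointwise-≡⇒≡; ≡⇒Pointwise-≡)
open import Data.List.Relation.Unary.All using (All; []; _∷_)
open import Data.List.Relation.Unary.All.Properties using (++⁻ʳ)
open import Data.List.Relation.Unary.Linked using (Linked; [-]; _∷_)
import Data.List.Relation.Unary.Linked as Linked
open import Data.List.Relation.Unary.Linked.Properties using (Linked⇒All)
open import Data.Nat using (ℕ; zero; suc; _<_; _≤_; _+_; z≤n; s≤s)
open import Data.Nat.Induction using (<-wellFounded)
import Data.Nat.Properties as ℕ
open import Data.Product using (_×_; _,_; ∃; ∃₂)
open import Data.Sum using (_⊎_; inj₁; inj₂)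
open import Function using (_∘_)
open import Function.Bundles using (_⇔_; mk⇔)
open import Induction.WellFounded using (Acc; acc)
open import Relation.Binary.Core using (Rel)
open import Relation.Binary.Definitions using (Transitive; Trichotomous; tri<; tri≈; tri>)
open import Relation.Binary.PropositionalEquality
  using (_≡_; _≢_; refl; sym; trans; cong; cong₂; subst; subst₂; isEquivalence; module ≡-Reasoning)
open import Relation.Nullary using (¬_)

Linked-++⁻ʳ : ∀ {a r} {A : Set a} {R : Rel A r} (xs : List A) {ys : List A} →
              Linked R (xs ++ ys) → Linked R ys
Linked-++⁻ʳ []       linked = linked
Linked-++⁻ʳ (_ ∷ xs) linked = Linked-++⁻ʳ xs (Linked.tail linked)

length-<-suffix : ∀ {a} {A : Set a} {w : List A} (u v : List A) →
                  w ≡ u ++ v → u ≢ [] → length v < length w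
length-<-suffix []      v _    u≢[] = ⊥-elim (u≢[] refl)
length-<-suffix (_ ∷ u) v refl _    = s≤s (length-++-≤ʳ v {u})

drop-length-++ : ∀ {a} {A : Set a} (xs : List A) {ys : List A} k →
                 drop (length xs + k) (xs ++ ys) ≡ drop k ys
drop-length-++ []       k = refl
drop-length-++ (_ ∷ xs) k = drop-length-++ xs k

drop-++-≤ : ∀ {a} {A : Set a} k (xs : List A) {ys : List A} →
            k ≤ length xs → drop k (xs ++ ys) ≡ drop k xs ++ ys
drop-++-≤ zero    xs       _         = refl
drop-++-≤ (suc k) (_ ∷ xs) (s≤s k≤n) = drop-++-≤ k xs k≤n

module _ {m : ℕ} where

  private variable
    ℓ p q s t x y z : Word m
    Rs : List (Word m)

  ++-levi : ∀ (a b c d : Word m) → a ++ b ≡ c ++ d →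
            (∃ λ (t : Word m) → c ≡ a ++ t × b ≡ t ++ d) ⊎
            (∃ λ (t : Word m) → a ≡ c ++ t × d ≡ t ++ b)
  ++-levi []      b c       d eq = inj₁ (c , refl , eq)
  ++-levi (x ∷ a) b []      d eq = inj₂ (x ∷ a , refl , sym eq)
  ++-levi (x ∷ a) b (y ∷ c) d eq with ∷-injective eq
  ... | refl , eq′ with ++-levi a b c d eq′
  ...   | inj₁ (t , refl , b≡) = inj₁ (t , refl , b≡)
  ...   | inj₂ (t , refl , d≡) = inj₂ (t , refl , d≡)

  <ʷ-irrefl : ¬ (x <ʷ x)
  <ʷ-irrefl = Lex.<-irreflexive Finₚ.<-irrefl (≡⇒Pointwise-≡ refl)

  <ʷ-asym : x <ʷ y → ¬ (y <ʷ x)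
  <ʷ-asym = Lex.<-asymmetric sym Finₚ.<-resp₂-≡ Finₚ.<-asym

  <ʷ-cmp : Trichotomous _≡_ (_<ʷ_ {m})
  <ʷ-cmp x y with Lex.<-compare sym Finₚ.<-cmp x y
  ... | tri< x<y x≉y x≯y = tri< x<y (x≉y ∘ ≡⇒Pointwise-≡) x≯y
  ... | tri≈ x≮y x≈y x≯y = tri≈ x≮y (Pointwise-≡⇒≡ x≈y) x≯y
  ... | tri> x≮y x≉y x>y = tri> x≮y (x≉y ∘ ≡⇒Pointwise-≡) x>y

  ≤ʷ-refl : x ≤ʷ x
  ≤ʷ-refl = Lex.≤-reflexive _≡_ F._<_ (≡⇒Pointwise-≡ refl)

  ≤ʷ-trans : Transitive (_≤ʷ_ {m})
  ≤ʷ-trans = Lex.≤-transitive isEquivalence Finₚ.<-resp₂-≡ Finₚ.<-trans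

  <ʷ⇒≤ʷ : x <ʷ y → x ≤ʷ y
  <ʷ⇒≤ʷ halt          = halt
  <ʷ⇒≤ʷ (this a<b)    = this a<b
  <ʷ⇒≤ʷ (next a≡b xy) = next a≡b (<ʷ⇒≤ʷ xy)

  ≤ʷ-<ʷ-trans : x ≤ʷ y → y <ʷ z → x <ʷ z
  ≤ʷ-<ʷ-trans (base _)       yz             = yz
  ≤ʷ-<ʷ-trans halt           (this _)       = halt
  ≤ʷ-<ʷ-trans halt           (next _ _)     = halt
  ≤ʷ-<ʷ-trans (this a<b)     (this b<c)     = this (Finₚ.<-trans a<b b<c)
  ≤ʷ-<ʷ-trans (this a<b)     (next refl _)  = this a<b
  ≤ʷ-<ʷ-trans (next refl _)  (this b<c)     = this b<c
  ≤ʷ-<ʷ-trans (next refl xy) (next refl yz) = next refl (≤ʷ-<ʷ-trans xy yz)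

  <ʷ-≤ʷ-trans : x <ʷ y → y ≤ʷ z → x <ʷ z
  <ʷ-≤ʷ-trans halt           (this _)       = halt
  <ʷ-≤ʷ-trans halt           (next _ _)     = halt
  <ʷ-≤ʷ-trans (this a<b)     (this b<c)     = this (Finₚ.<-trans a<b b<c)
  <ʷ-≤ʷ-trans (this a<b)     (next refl _)  = this a<b
  <ʷ-≤ʷ-trans (next refl _)  (this b<c)     = this b<c
  <ʷ-≤ʷ-trans (next refl xy) (next refl yz) = next refl (<ʷ-≤ʷ-trans xy yz)

  ++-monoʳ-<ʷ : ∀ w → x <ʷ y → (w ++ x) <ʷ (w ++ y)
  ++-monoʳ-<ʷ []      xy = xy
  ++-monoʳ-<ʷ (_ ∷ w) xy = next refl (++-monoʳ-<ʷ w xy)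

  ++-cancelˡ-<ʷ : ∀ w → (w ++ x) <ʷ (w ++ y) → x <ʷ y
  ++-cancelˡ-<ʷ []      xy          = xy
  ++-cancelˡ-<ʷ (_ ∷ w) (this a<a)  = ⊥-elim (Finₚ.<-irrefl refl a<a)
  ++-cancelˡ-<ʷ (_ ∷ w) (next _ xy) = ++-cancelˡ-<ʷ w xy

  _⊏_ : Word m → Word m → Set
  x ⊏ y = ∃₂ λ (e : Fin m) (z : Word m) → y ≡ x ++ e ∷ z

  -- Unlike x <ʷ y, a mismatch x ≺ y survives appending arbitrary words to x and y.
  infix 4 _≺_
  data _≺_ : Word m → Word m → Set where
    here  : ∀ {a b x y} → a F.< b → a ∷ x ≺ b ∷ y
    there : ∀ {a x y} → x ≺ y → a ∷ x ≺ a ∷ y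

  ≺-++ : x ≺ y → ∀ u v → x ++ u ≺ y ++ v
  ≺-++ (here a<b) u v = here a<b
  ≺-++ (there xy) u v = there (≺-++ xy u v)

  ≺⇒<ʷ : x ≺ y → x <ʷ y
  ≺⇒<ʷ (here a<b) = this a<b
  ≺⇒<ʷ (there xy) = next refl (≺⇒<ʷ xy)

  ≺-++⇒<ʷ : x ≺ y → ∀ u v → (x ++ u) <ʷ (y ++ v)
  ≺-++⇒<ʷ xy u v = ≺⇒<ʷ (≺-++ xy u v)

  <ʷ⇒≺⊎⊏ : x <ʷ y → x ≺ y ⊎ x ⊏ y
  <ʷ⇒≺⊎⊏ halt       = inj₂ (_ , _ , refl)
  <ʷ⇒≺⊎⊏ (this a<b) = inj₁ (here a<b)
  <ʷ⇒≺⊎⊏ (next refl xy) with <ʷ⇒≺⊎⊏ xy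
  ... | inj₁ x≺y           = inj₁ (there x≺y)
  ... | inj₂ (e , z , refl) = inj₂ (e , z , refl)

  <ʷ-shorter⇒≺ : x <ʷ y → length y ≤ length x → x ≺ y
  <ʷ-shorter⇒≺ (this a<b)     _         = here a<b
  <ʷ-shorter⇒≺ (next refl xy) (s≤s y≤x) = there (<ʷ-shorter⇒≺ xy y≤x)

  infixr 8 _^_
  _^_ : Word m → ℕ → Word m
  u ^ k = concat (replicate k u)

  ^-+ : ∀ u a b → u ^ a ++ u ^ b ≡ u ^ (a + b)
  ^-+ u zero    b = refl
  ^-+ u (suc a) b = trans (++-assoc u (u ^ a) (u ^ b)) (cong (u ++_) (^-+ u a b))

  CommonRoot : Word m → Word m → Set
  CommonRoot p q = ∃₂ λ (u : Word m) (a : ℕ) → ∃ λ (b : ℕ) → p ≡ u ^ suc a × q ≡ u ^ suc b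

  commute⇒CommonRoot : p ≢ [] → q ≢ [] → p ++ q ≡ q ++ p → CommonRoot p q
  commute⇒CommonRoot {p} {q} = go p q (<-wellFounded (length p + length q))
    where
    go : ∀ p q → Acc _<_ (length p + length q) →
         p ≢ [] → q ≢ [] → p ++ q ≡ q ++ p → CommonRoot p q
    go p q (acc rec) p≢[] q≢[] pq≡qp with ++-levi p q q p pq≡qp
    ... | inj₁ ([] , q≡p , _) = p , 0 , 0 , sym (++-identityʳ p) , q≡p
    ... | inj₂ ([] , p≡q , _) = q , 0 , 0 , p≡q , sym (++-identityʳ q)
    ... | inj₁ (t@(_ ∷ _) , q≡pt , q≡tp)
      with go p t (rec (ℕ.+-monoʳ-< (length p) (length-<-suffix p t q≡pt p≢[])))
              p≢[] (λ ()) (trans (sym q≡pt) q≡tp)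
    ...   | u , a , b , p≡ , t≡ =
            u , a , a + suc b , p≡ , trans q≡pt (trans (cong₂ _++_ p≡ t≡) (^-+ u (suc a) (suc b)))
    go p q (acc rec) p≢[] q≢[] pq≡qp
        | inj₂ (t@(_ ∷ _) , p≡qt , p≡tq)
      with go t q (rec (ℕ.+-monoˡ-< (length q) (length-<-suffix q t p≡qt q≢[])))
              (λ ()) q≢[] (trans (sym p≡tq) p≡qt)
    ...   | u , a , b , t≡ , q≡ =
            u , a + suc b , b , trans p≡tq (trans (cong₂ _++_ t≡ q≡) (^-+ u (suc a) (suc b))) , q≡

  commute⇒¬Primitive : p ≢ [] → q ≢ [] → p ++ q ≡ q ++ p → ¬ Primitive (p ++ q)
  commute⇒¬Primitive p≢[] q≢[] pq≡qp prim
    with commute⇒CommonRoot p≢[] q≢[] pq≡qp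
  ... | u , a , b , refl , refl =
        prim (u , suc a + suc b , s≤s (ℕ.≤-trans (s≤s z≤n) (ℕ.m≤n+m (suc b) a)) ,
              ^-+ u (suc a) (suc b))

  Lyndon-<ʷ-conjugate : Lyndon ℓ → ℓ ≡ p ++ q → p ≢ [] → q ≢ [] → ℓ <ʷ (q ++ p)
  Lyndon-<ʷ-conjugate {p = p} {q = q} (_ , prim , minimal) refl p≢[] q≢[] =
    minimal p q refl (λ qp≡pq → commute⇒¬Primitive p≢[] q≢[] (sym qp≡pq) prim)

  Lyndon-unbordered : Lyndon ℓ → ℓ ≡ p ++ s → ℓ ≡ s ++ t → p ≢ [] → s ≢ [] → t ≢ [] → ⊥
  Lyndon-unbordered {ℓ = ℓ} {p = p} {s = s} {t = t} lyn ℓ≡ps ℓ≡st p≢[] s≢[] t≢[] =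
    <ʷ-asym (Lyndon-<ʷ-conjugate lyn ℓ≡st s≢[] t≢[]) ts<ℓ
    where
    open ≡-Reasoning
    t<p : t <ʷ p
    t<p = ++-cancelˡ-<ʷ s (subst (_<ʷ (s ++ p)) ℓ≡st (Lyndon-<ʷ-conjugate lyn ℓ≡ps p≢[] s≢[]))
    |p|≡|t| : length p ≡ length t
    |p|≡|t| = ℕ.+-cancelʳ-≡ (length s) (length p) (length t) (begin
      length p + length s  ≡⟨ length-++ p ⟨
      length (p ++ s)      ≡⟨ cong length (trans (sym ℓ≡ps) ℓ≡st) ⟩
      length (s ++ t)      ≡⟨ length-++ s ⟩
      length s + length t  ≡⟨ ℕ.+-comm (length s) (length t) ⟩
      length t + length s  ∎)
    ts<ℓ : (t ++ s) <ʷ ℓ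
    ts<ℓ = subst ((t ++ s) <ʷ_) (sym ℓ≡ps)
             (≺-++⇒<ʷ (<ʷ-shorter⇒≺ t<p (ℕ.≤-reflexive |p|≡|t|)) s s)

  Lyndon-<ʷ-suffix : Lyndon ℓ → ℓ ≡ p ++ s → p ≢ [] → s ≢ [] → ℓ <ʷ s
  Lyndon-<ʷ-suffix {ℓ = ℓ} {p = p} {s = s} lyn ℓ≡ps p≢[] s≢[] with <ʷ-cmp ℓ s
  ... | tri< ℓ<s _ _ = ℓ<s
  ... | tri≈ _ refl _ = ⊥-elim (p≢[] (++-identityˡ-unique p ℓ≡ps))
  ... | tri> _ _ s<ℓ with <ʷ⇒≺⊎⊏ s<ℓ
  ...   | inj₁ s≺ℓ = ⊥-elim (<ʷ-asym (Lyndon-<ʷ-conjugate lyn ℓ≡ps p≢[] s≢[]) sp<ℓ)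
    where
    sp<ℓ : (s ++ p) <ʷ ℓ
    sp<ℓ = subst ((s ++ p) <ʷ_) (++-identityʳ ℓ) (≺-++⇒<ʷ s≺ℓ p [])
  ...   | inj₂ (_ , _ , ℓ≡s·ez) = ⊥-elim (Lyndon-unbordered lyn ℓ≡ps ℓ≡s·ez p≢[] s≢[] (λ ()))

  Lyndon-++-≤ʷ-suffix-++ : Lyndon ℓ → ℓ ≡ p ++ s → s ≢ [] → ∀ z → (ℓ ++ z) ≤ʷ (s ++ z)
  Lyndon-++-≤ʷ-suffix-++ {p = []}    _   refl  _    z = ≤ʷ-refl
  Lyndon-++-≤ʷ-suffix-++ {ℓ = ℓ} {p = a ∷ p} {s = s} lyn ℓ≡ps s≢[] z =
    <ʷ⇒≤ʷ (≺-++⇒<ʷ (<ʷ-shorter⇒≺ (Lyndon-<ʷ-suffix lyn ℓ≡ps (λ ()) s≢[]) |s|≤|ℓ|) z z)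
    where
    |s|≤|ℓ| : length s ≤ length ℓ
    |s|≤|ℓ| = ℕ.<⇒≤ (length-<-suffix (a ∷ p) s ℓ≡ps (λ ()))

  concat-<ʷ-suffix-++ : Lyndon ℓ → ℓ ≡ p ++ s → p ≢ [] → s ≢ [] →
                        All (_≤ʷ ℓ) Rs → ∀ z → concat Rs <ʷ (s ++ z)
  concat-<ʷ-suffix-++ {s = []}    _ _ _ s≢[] [] _ = ⊥-elim (s≢[] refl)
  concat-<ʷ-suffix-++ {s = _ ∷ _} _ _ _ _    [] _ = halt
  concat-<ʷ-suffix-++ {ℓ = ℓ} {p = p} {Rs = Q ∷ Rs} lyn ℓ≡ps p≢[] s≢[] (Q≤ℓ ∷ Rs≤ℓ) z
    with <ʷ⇒≺⊎⊏ (≤ʷ-<ʷ-trans Q≤ℓ (Lyndon-<ʷ-suffix lyn ℓ≡ps p≢[] s≢[]))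
  ... | inj₁ Q≺s = ≺-++⇒<ʷ Q≺s (concat Rs) z
  ... | inj₂ (e , y , refl) =
        subst ((Q ++ concat Rs) <ʷ_) (sym (++-assoc Q (e ∷ y) z))
          (++-monoʳ-<ʷ Q (concat-<ʷ-suffix-++ lyn ℓ≡pQ·ey (p≢[] ∘ ++-conicalˡ p Q) (λ ()) Rs≤ℓ z))
    where
    ℓ≡pQ·ey : ℓ ≡ (p ++ Q) ++ e ∷ y
    ℓ≡pQ·ey = trans ℓ≡ps (sym (++-assoc p Q (e ∷ y)))

  concat-<ʷ-Lyndon-++ : Lyndon ℓ → All (_≤ʷ ℓ) Rs → concat Rs <ʷ (ℓ ++ concat Rs)
  concat-<ʷ-Lyndon-++ {ℓ = []}    (ℓ≢[] , _) [] = ⊥-elim (ℓ≢[] refl)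
  concat-<ʷ-Lyndon-++ {ℓ = _ ∷ _} _          [] = halt
  concat-<ʷ-Lyndon-++ {Rs = [] ∷ Rs} lyn (_ ∷ Rs≤ℓ) = concat-<ʷ-Lyndon-++ lyn Rs≤ℓ
  concat-<ʷ-Lyndon-++ {ℓ = ℓ} {Rs = R@(_ ∷ _) ∷ Rs} lyn (R≤ℓ ∷ Rs≤ℓ) with <ʷ-cmp R ℓ
  ... | tri≈ _ refl _ = ++-monoʳ-<ʷ R (concat-<ʷ-Lyndon-++ lyn Rs≤ℓ)
  ... | tri> _ _ ℓ<R  = ⊥-elim (<ʷ-irrefl (≤ʷ-<ʷ-trans R≤ℓ ℓ<R))
  ... | tri< R<ℓ _ _ with <ʷ⇒≺⊎⊏ R<ℓ
  ...   | inj₁ R≺ℓ = ≺-++⇒<ʷ R≺ℓ (concat Rs) (R ++ concat Rs)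
  ...   | inj₂ (e , y , refl) =
          subst ((R ++ concat Rs) <ʷ_) (sym (++-assoc R (e ∷ y) (R ++ concat Rs)))
            (++-monoʳ-<ʷ R (concat-<ʷ-suffix-++ {p = R} {s = e ∷ y} lyn refl (λ ()) (λ ())
                                                 Rs≤ℓ (R ++ concat Rs)))

  _≥ʷ_ : Word m → Word m → Set
  x ≥ʷ y = y ≤ʷ x

  Decreasing⇒bounded : Linked _≥ʷ_ (ℓ ∷ Rs) → All (_≤ʷ ℓ) Rs
  Decreasing⇒bounded [-]                = []
  Decreasing⇒bounded (ℓ≥R ∷ decreasing) =
    Linked⇒All (λ x≥y y≥z → ≤ʷ-trans y≥z x≥y) ℓ≥R decreasing

  concat-≤ʷ-concat-++ : ∀ As {Bs} → All Lyndon (As ++ Bs) → Linked _≥ʷ_ (As ++ Bs) →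
                        concat Bs ≤ʷ concat (As ++ Bs)
  concat-≤ʷ-concat-++ []       _             _          = ≤ʷ-refl
  concat-≤ʷ-concat-++ (_ ∷ As) (lyn ∷ lyns) decreasing =
    <ʷ⇒≤ʷ (≤ʷ-<ʷ-trans (concat-≤ʷ-concat-++ As lyns (Linked.tail decreasing))
                        (concat-<ʷ-Lyndon-++ lyn (Decreasing⇒bounded decreasing)))

  MinimalAfter : Word m → Word m → Set
  MinimalAfter u v = ∀ p z → z ≢ [] → u ≡ p ++ z → v <ʷ (z ++ v)

  Lyndon-factors⇒MinimalAfter : ∀ As Bs → All Lyndon (As ++ Bs) → Linked _≥ʷ_ (As ++ Bs) →
                                MinimalAfter (concat As) (concat Bs)
  Lyndon-factors⇒MinimalAfter [] Bs _ _ p z z≢[] []≡pz =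
    ⊥-elim (z≢[] (++-conicalʳ p z (sym []≡pz)))
  Lyndon-factors⇒MinimalAfter (L ∷ As) Bs (lyn ∷ lyns) decreasing p z z≢[] L·As≡pz
    with ++-levi L (concat As) p z L·As≡pz
  ... | inj₁ (t , _ , As≡tz) =
        Lyndon-factors⇒MinimalAfter As Bs lyns (Linked.tail decreasing) t z z≢[] As≡tz
  ... | inj₂ ([] , _ , z≡As) =
        Lyndon-factors⇒MinimalAfter As Bs lyns (Linked.tail decreasing) [] z z≢[] (sym z≡As)
  ... | inj₂ (t@(_ ∷ _) , L≡pt , refl) =
        subst (concat Bs <ʷ_) suffix-assoc
          (≤ʷ-<ʷ-trans (concat-≤ʷ-concat-++ As lyns (Linked.tail decreasing))
            (<ʷ-≤ʷ-trans (concat-<ʷ-Lyndon-++ lyn (Decreasing⇒bounded decreasing))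
                         (Lyndon-++-≤ʷ-suffix-++ lyn L≡pt (λ ()) (concat (As ++ Bs)))))
    where
    suffix-assoc : t ++ concat (As ++ Bs) ≡ (t ++ concat As) ++ concat Bs
    suffix-assoc = trans (cong (t ++_) (sym (concat-++ As Bs)))
                         (sym (++-assoc t (concat As) (concat Bs)))

  <ʷ⇔++-<ʷ : ∀ {u v w} → MinimalAfter u v → u ≡ w ++ x → length y ≤ length x →
             (x <ʷ y) ⇔ ((x ++ v) <ʷ (y ++ v))
  <ʷ⇔++-<ʷ {x = x} {y = y} {u = u} {v = v} {w = w} minimal u≡wx |y|≤|x| = mk⇔ append remove
    where
    append : x <ʷ y → (x ++ v) <ʷ (y ++ v)
    append x<y = ≺-++⇒<ʷ (<ʷ-shorter⇒≺ x<y |y|≤|x|) v v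
    remove : (x ++ v) <ʷ (y ++ v) → x <ʷ y
    remove xv<yv with <ʷ-cmp x y
    ... | tri< x<y _ _ = x<y
    ... | tri≈ _ refl _ = ⊥-elim (<ʷ-irrefl xv<yv)
    ... | tri> _ _ y<x with <ʷ⇒≺⊎⊏ y<x
    ...   | inj₁ y≺x = ⊥-elim (<ʷ-asym xv<yv (≺-++⇒<ʷ y≺x v v))
    ...   | inj₂ (e , z , refl) =
            ⊥-elim (<ʷ-asym (minimal (w ++ y) (e ∷ z) (λ ()) u≡wy·ez) (++-cancelˡ-<ʷ y ezv<v))
      where
      u≡wy·ez : u ≡ (w ++ y) ++ e ∷ z
      u≡wy·ez = trans u≡wx (sym (++-assoc w y (e ∷ z)))
      ezv<v : (y ++ (e ∷ z) ++ v) <ʷ (y ++ v)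
      ezv<v = subst (_<ʷ (y ++ v)) (++-assoc y (e ∷ z) v) xv<yv

theorem2 : ∀ {m : ℕ} (W : Word m) → W ≢ [] →
    (pre mid post : List (Word m)) →
    IsLyndonFactorization W (pre ++ mid ++ post) → mid ≢ [] →
    (i j : ℕ) → i < j → j < length (concat mid) →
    (drop i (concat mid) <ʷ drop j (concat mid))
      ⇔ (drop (length (concat pre) + i) W <ʷ drop (length (concat pre) + j) W)
theorem2 {m} W _ pre mid post (lyndon , decreasing , concat≡W) _ i j i<j j<|u| =
  subst₂ (λ a b → (drop i u <ʷ drop j u) ⇔ (a <ʷ b)) (sym (drop-W i≤|u|)) (sym (drop-W j≤|u|))
    (<ʷ⇔++-<ʷ (Lyndon-factors⇒MinimalAfter mid post (++⁻ʳ pre lyndon) (Linked-++⁻ʳ pre decreasing))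
              (sym (take++drop≡id i u)) |drop-j|≤|drop-i|)
  where
  u v : Word m
  u = concat mid
  v = concat post
  j≤|u| : j ≤ length u
  j≤|u| = ℕ.<⇒≤ j<|u|
  i≤|u| : i ≤ length u
  i≤|u| = ℕ.≤-trans (ℕ.<⇒≤ i<j) j≤|u|
  |drop-j|≤|drop-i| : length (drop j u) ≤ length (drop i u)
  |drop-j|≤|drop-i| = subst₂ _≤_ (sym (length-drop j u)) (sym (length-drop i u))
                        (ℕ.∸-monoʳ-≤ (length u) (ℕ.<⇒≤ i<j))
  W≡pre·u·v : W ≡ concat pre ++ u ++ v
  W≡pre·u·v = begin
    W                                  ≡⟨ concat≡W ⟨
    concat (pre ++ mid ++ post)        ≡⟨ concat-++ pre (mid ++ post) ⟨
    concat pre ++ concat (mid ++ post) ≡⟨ cong (concat pre ++_) (concat-++ mid post) ⟨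
    concat pre ++ u ++ v               ∎
    where open ≡-Reasoning
  drop-W : ∀ {k} → k ≤ length u → drop (length (concat pre) + k) W ≡ drop k u ++ v
  drop-W {k} k≤|u| = trans (cong (drop (length (concat pre) + k)) W≡pre·u·v)
                       (trans (drop-length-++ (concat pre) k) (drop-++-≤ k u k≤|u|))
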